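{- Let $L=E[C_1,\dots,C_n]$ be a congruence normal lattice, obtained from the one-element lattice by successively doubling nonempty convex subsets $C_1,\dots,C_n$. If $L$ is shellable, then for every $i$, $C_i$ intersects the spine of $E[C_1,\dots,C_{i-1}]$.
   Context: All lattices are finite. For a convex subset $C$ of $L$, $I_L(C)=\{y\mid\exists x\in C,y\le x\}$ and the doubling $L[C]$ is the subposet of $L\times\{0<1\}$ on $(I_L(C)\times\{0\})\sqcup\big(((L\setminus I_L(C))\cup C)\times\{1\}\big)$. $E[\,]$ is the one-element lattice and $E[C_1,\dots,C_{i+1}]=E[C_1,\dots,C_i][C_{i+1}]$. The spine is the set of elements lying on some chain of maximum length. The order complex $\Delta(L)$ is the simplicial complex on vertex set $L$ (including $\hat 0$ and $\hat 1$) whose faces are the chains of $L$; its facets are the maximal chains. $L$ is shellable if $\Delta(L)$ is shellable: there is a linear order $F_1,\dots,F_k$ of its facets such that for each $1\le j<k$, the complex $\big(\bigcup_{i\le j}\langle F_i\rangle\big)\cap\langle F_{j+1}\rangle$ is pure of dimension $|F_{j+1}|-2$, where $\langle F\rangle$ is the set of subsets of $F$. -}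

module Defs where

open import Data.Nat using (ℕ; zero; suc; _≤_; _<_; _∸_)
open import Data.Bool using (Bool; true; false; _∧_) renaming (_≤_ to _≤B_)
open import Data.Vec using (Vec; []; _∷_)
open import Data.Vec.Relation.Binary.Pointwise.Inductive using (Pointwise)
open import Data.List using (List; []; _∷_; map; _++_; length; filterᵇ)
open import Data.Fin using (Fin; toℕ)
open import Data.Product using (Σ; ∃; _×_; _,_)
open import Data.Sum using (_⊎_)
open import Data.Unit using (⊤)
open import Relation.Nullary using (¬_)
open import Relation.Binary.PropositionalEquality using (_≡_)

-- Every lattice E[C₁,…,Cₙ] is (up to isomorphism) a subposet of the
-- product {0<1}ⁿ: each doubling L[C] ⊆ L × {0<1} adds one coordinate.
-- We therefore represent its elements as Boolean vectors of length n,
-- ordered componentwise (the product order).  The new coordinate of a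
-- doubling is prepended.

_≼_ : ∀ {n} → Vec Bool n → Vec Bool n → Set
_≼_ = Pointwise _≤B_

Subset : ℕ → Set
Subset n = Vec Bool n → Bool

data Seq : ℕ → Set where
  []  : Seq zero
  _▷_ : ∀ {n} → Seq n → Subset n → Seq (suc n)

mutual
  InE : ∀ {n} → Seq n → Vec Bool n → Set
  InE [] [] = ⊤
  InE (cs ▷ C) (false ∷ x) = InE cs x × DownSet cs C x
  InE (cs ▷ C) (true ∷ x)  = InE cs x × ((¬ DownSet cs C x) ⊎ C x ≡ true)

  DownSet : ∀ {n} → Seq n → Subset n → Vec Bool n → Set
  DownSet cs C y = ∃ λ x → C x ≡ true × (y ≼ x)

NonemptyConvex : ∀ {n} → Seq n → Subset n → Set
NonemptyConvex cs C =
  (∀ x → C x ≡ true → InE cs x) ×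
  (∃ λ x → C x ≡ true) ×
  (∀ x y z → InE cs y → C x ≡ true → C z ≡ true → x ≼ y → y ≼ z → C y ≡ true)

Valid : ∀ {n} → Seq n → Set
Valid [] = ⊤
Valid (cs ▷ C) = Valid cs × NonemptyConvex cs C

data _⊑_ : ∀ {m n} → Seq m → Seq n → Set where
  here  : ∀ {n} {cs : Seq n} → cs ⊑ cs
  there : ∀ {m n} {cs : Seq m} {ds : Seq n} {C : Subset n} → cs ⊑ ds → cs ⊑ (ds ▷ C)

allVecs : (n : ℕ) → List (Vec Bool n)
allVecs zero = [] ∷ []
allVecs (suc n) = map (false ∷_) (allVecs n) ++ map (true ∷_) (allVecs n)

card : ∀ {n} → Subset n → ℕ
card {n} A = length (filterᵇ A (allVecs n))

_⊆_ : ∀ {n} → Subset n → Subset n → Set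
A ⊆ B = ∀ x → A x ≡ true → B x ≡ true

_∩_ : ∀ {n} → Subset n → Subset n → Subset n
(A ∩ B) x = A x ∧ B x

Chain : ∀ {n} → Seq n → Subset n → Set
Chain cs A = (∀ x → A x ≡ true → InE cs x) ×
             (∀ x y → A x ≡ true → A y ≡ true → (x ≼ y) ⊎ (y ≼ x))

MaximalChain : ∀ {n} → Seq n → Subset n → Set
MaximalChain cs A = Chain cs A × (∀ B → Chain cs B → A ⊆ B → B ⊆ A)

MaximumChain : ∀ {n} → Seq n → Subset n → Set
MaximumChain cs A = Chain cs A × (∀ B → Chain cs B → card B ≤ card A)

Spine : ∀ {n} → Seq n → Vec Bool n → Set
Spine cs x = ∃ λ A → MaximumChain cs A × A x ≡ true

Complex : ℕ → Set₁
Complex n = Subset n → Set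

IsFacetOf : ∀ {n} → Complex n → Subset n → Set
IsFacetOf K H = K H × (∀ G → K G → H ⊆ G → G ⊆ H)

-- K is pure of dimension d, where s = d + 1 is the common facet size.
PureOfSize : ∀ {n} → Complex n → ℕ → Set
PureOfSize K s = ∀ H → IsFacetOf K H → card H ≡ s

-- (⋃_{i ≤ j} ⟨F_i⟩) ∩ ⟨F_{j+1}⟩ with facets indexed from 0: the faces
-- G ⊆ F m that lie in some F i with i < m.
PrefixIntersection : ∀ {n k} → (Fin k → Subset n) → Fin k → Complex n
PrefixIntersection F m G = (G ⊆ F m) × (∃ λ i → (toℕ i < toℕ m) × (G ⊆ F i))

-- Shellability of Δ(E[cs]): a linear order F₀,…,F_{k-1} of all its
-- facets (each maximal chain appears exactly once, sets compared
-- extensionally) such that each intersection complex for m ≥ 1 is pure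
-- of dimension |F m| - 2, i.e. its facets have size |F m| - 1.
Shellable : ∀ {n} → Seq n → Set
Shellable {n} cs =
  Σ ℕ λ k → Σ (Fin k → Subset n) λ F →
    (∀ i → MaximalChain cs (F i)) ×
    (∀ A → MaximalChain cs A → ∃ λ i → (A ⊆ F i) × (F i ⊆ A)) ×
    (∀ i j → F i ⊆ F j → F j ⊆ F i → i ≡ j) ×
    (∀ m → 1 ≤ toℕ m → PureOfSize (PrefixIntersection F m) (card (F m) ∸ 1))

{-# OPTIONS --safe #-}
module Submission where

-- A maximal chain of a doubling L[C] projects onto a maximal chain of L, and if it meets
-- C × {0,1} it contains a whole doubled edge (d,0) < (d,1): take the top of its part in
-- L × {0}, or the bottom of its part in L × {1}.  Let F₀,…,F_{k−1} be the shelling and fix a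
-- stage E[C₁,…,Cᵢ].  If the image of F_j (j ≥ 1) there contains a doubled edge, pick l < j with
-- |F_j ∩ F_l| largest.  Then F_j ∩ F_l is a facet of (⋃_{l<j} ⟨F_l⟩) ∩ ⟨F_j⟩, so by purity it
-- misses only one vertex of F_j and contains a lift of an end of the edge: the image of F_l
-- meets Cᵢ × {0,1}.  Descending from a facet through a lift of a point of Cᵢ × {0}, the image
-- of F₀ contains a doubled edge at every stage.  Hence its image in E[C₁,…,C_{i−1}] gains an
-- element at each of the i−1 doublings, so it has i elements, the most a chain in {0,1}^{i−1}
-- can have; so it is a maximum chain, and it contains the point of Cᵢ doubled by the edge at stage i.

open import Defs
open import Data.Nat using (ℕ; zero; suc; _≤_; _<_; _∸_; _+_; z≤n; s≤s; _≤?_)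
import Data.Nat.Properties as ℕ
open import Data.Bool using (Bool; true; false; _∧_; _∨_; f≤t; b≤b)
import Data.Bool.Properties as 𝔹
open import Data.Vec using (Vec; []; _∷_)
import Data.Vec.Properties as Vec
import Data.Vec.Relation.Binary.Pointwise.Inductive as Pointwise
open Pointwise using ([]; _∷_)
open import Data.List using (List; []; _∷_; map; _++_; length; filterᵇ)
open import Data.List.Properties using (length-++; filter-++; length-filter)
open import Data.List.Membership.Propositional using (_∈_; lose)
open import Data.List.Membership.Propositional.Properties using (∈-++⁺ˡ; ∈-++⁺ʳ; ∈-map⁺)
open import Data.List.Relation.Unary.Any using (here; there)
import Data.List.Relation.Unary.Any as Any
import Data.List.Relation.Unary.All as All
open import Data.Fin using (Fin; toℕ) renaming (zero to fzero; suc to fsuc)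
import Data.Fin as Fin
import Data.Fin.Induction as Fin
open import Data.Product using (∃; ∃₂; _×_; _,_; proj₁; proj₂)
open import Data.Sum using (_⊎_; inj₁; inj₂)
import Data.Sum as Sum
open import Induction.WellFounded using (Acc; acc)
open import Data.Nat.Induction using (<-wellFounded)
open import Data.Unit using (⊤; tt)
open import Function using (_∘_)
open import Relation.Nullary using (¬_; Dec; yes; no; does; contradiction)
open import Relation.Nullary.Decidable
  using (map′; decidable-stable; dec-true; dec-false; _×-dec_; _⊎-dec_; _→-dec_; ¬?)
open import Relation.Unary using (Pred; Decidable)
open import Relation.Binary using (Rel; Reflexive; Transitive)
open import Relation.Binary.PropositionalEquality
  using (_≡_; _≢_; refl; sym; trans; cong; cong₂; subst; module ≡-Reasoning)

≼-refl : ∀ {n} {x : Vec Bool n} → x ≼ x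
≼-refl = Pointwise.refl 𝔹.≤-refl

≼-trans : ∀ {n} {x y z : Vec Bool n} → x ≼ y → y ≼ z → x ≼ z
≼-trans = Pointwise.trans 𝔹.≤-trans

≼-antisym : ∀ {n} {x y : Vec Bool n} → x ≼ y → y ≼ x → x ≡ y
≼-antisym []       []       = refl
≼-antisym (p ∷ ps) (q ∷ qs) = cong₂ _∷_ (𝔹.≤-antisym p q) (≼-antisym ps qs)

_≼?_ : ∀ {n} (x y : Vec Bool n) → Dec (x ≼ y)
_≼?_ = Pointwise.decidable 𝔹._≤?_

true⋠false : ∀ {n} {x y : Vec Bool n} → ¬ (true ∷ x) ≼ (false ∷ y)
true⋠false (() ∷ _)

Comparable : ∀ {n} → Vec Bool n → Vec Bool n → Set
Comparable x y = x ≼ y ⊎ y ≼ x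

ComparableWith : ∀ {n} → Subset n → Vec Bool n → Set
ComparableWith A z = ∀ y → A y ≡ true → Comparable y z

Linear : ∀ {n} → Subset n → Set
Linear A = ∀ x y → A x ≡ true → A y ≡ true → Comparable x y

allVecs-complete : ∀ {n} (x : Vec Bool n) → x ∈ allVecs n
allVecs-complete []                = here refl
allVecs-complete {suc n} (false ∷ x) = ∈-++⁺ˡ (∈-map⁺ (false ∷_) (allVecs-complete x))
allVecs-complete {suc n} (true ∷ x)  =
  ∈-++⁺ʳ (map (false ∷_) (allVecs n)) (∈-map⁺ (true ∷_) (allVecs-complete x))

any? : ∀ {n p} {P : Pred (Vec Bool n) p} → Decidable P → Dec (∃ P)
any? P? = map′ Any.satisfied (λ (x , px) → lose (allVecs-complete x) px) (Any.any? P? _)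

all? : ∀ {n p} {P : Pred (Vec Bool n) p} → Decidable P → Dec (∀ x → P x)
all? P? = map′ (λ ps x → All.lookup ps (allVecs-complete x)) (λ ps → All.tabulate (λ {x} _ → ps x))
               (All.all? P? _)

DownSet? : ∀ {n} (cs : Seq n) (C : Subset n) → Decidable (DownSet cs C)
DownSet? cs C y = any? (λ x → (C x 𝔹.≟ true) ×-dec (y ≼? x))

ComparableWith? : ∀ {n} (A : Subset n) → Decidable (ComparableWith A)
ComparableWith? A z = all? (λ y → (A y 𝔹.≟ true) →-dec ((y ≼? z) ⊎-dec (z ≼? y)))

InE? : ∀ {n} (cs : Seq n) → Decidable (InE cs)
InE? []       []          = yes tt
InE? (cs ▷ C) (false ∷ x) = InE? cs x ×-dec DownSet? cs C x
InE? (cs ▷ C) (true ∷ x)  = InE? cs x ×-dec (¬? (DownSet? cs C x) ⊎-dec (C x 𝔹.≟ true))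

-- Counting subsets of {0,1}ⁿ

module _ {a} {A : Set a} {P Q : A → Bool} where

  length-filterᵇ-mono : (∀ x → P x ≡ true → Q x ≡ true) →
                        ∀ xs → length (filterᵇ P xs) ≤ length (filterᵇ Q xs)
  length-filterᵇ-mono P⊆Q [] = z≤n
  length-filterᵇ-mono P⊆Q (x ∷ xs) with P x in px | Q x in qx
  ... | true  | true  = s≤s (length-filterᵇ-mono P⊆Q xs)
  ... | true  | false = contradiction (trans (sym (P⊆Q x px)) qx) λ ()
  ... | false | true  = ℕ.m≤n⇒m≤1+n (length-filterᵇ-mono P⊆Q xs)
  ... | false | false = length-filterᵇ-mono P⊆Q xs

  length-filterᵇ-mono-< : (∀ x → P x ≡ true → Q x ≡ true) → ∀ {x xs} → x ∈ xs →
                          P x ≡ false → Q x ≡ true → length (filterᵇ P xs) < length (filterᵇ Q xs)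
  length-filterᵇ-mono-< P⊆Q {xs = _ ∷ xs} (here refl) px qx rewrite px | qx =
    s≤s (length-filterᵇ-mono P⊆Q xs)
  length-filterᵇ-mono-< P⊆Q {xs = y ∷ xs} (there x∈xs) px qx with P y in py | Q y in qy
  ... | true  | true  = s≤s (length-filterᵇ-mono-< P⊆Q x∈xs px qx)
  ... | true  | false = contradiction (trans (sym (P⊆Q y py)) qy) λ ()
  ... | false | true  = ℕ.m<n⇒m<1+n (length-filterᵇ-mono-< P⊆Q x∈xs px qx)
  ... | false | false = length-filterᵇ-mono-< P⊆Q x∈xs px qx

  length-filterᵇ-∨-∧ : ∀ xs → length (filterᵇ P xs) + length (filterᵇ Q xs) ≡
                              length (filterᵇ (λ x → P x ∨ Q x) xs) + length (filterᵇ (λ x → P x ∧ Q x) xs)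
  length-filterᵇ-∨-∧ [] = refl
  length-filterᵇ-∨-∧ (x ∷ xs) with P x | Q x
  ... | true  | true  =
    cong suc (trans (ℕ.+-suc _ _) (trans (cong suc (length-filterᵇ-∨-∧ xs)) (sym (ℕ.+-suc _ _))))
  ... | true  | false = cong suc (length-filterᵇ-∨-∧ xs)
  ... | false | true  = trans (ℕ.+-suc _ _) (cong suc (length-filterᵇ-∨-∧ xs))
  ... | false | false = length-filterᵇ-∨-∧ xs

length-filterᵇ-map : ∀ {a b} {A : Set a} {B : Set b} (P : B → Bool) (f : A → B) xs →
                     length (filterᵇ P (map f xs)) ≡ length (filterᵇ (P ∘ f) xs)
length-filterᵇ-map P f [] = refl
length-filterᵇ-map P f (x ∷ xs) with P (f x)
... | true  = cong suc (length-filterᵇ-map P f xs)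
... | false = length-filterᵇ-map P f xs

module _ {n : ℕ} where

  card-mono : {A B : Subset n} → A ⊆ B → card A ≤ card B
  card-mono A⊆B = length-filterᵇ-mono A⊆B (allVecs n)

  card-mono-< : {A B : Subset n} → A ⊆ B → ∀ x → A x ≡ false → B x ≡ true → card A < card B
  card-mono-< A⊆B x = length-filterᵇ-mono-< A⊆B (allVecs-complete x)

  card≤length-allVecs : (A : Subset n) → card A ≤ length (allVecs n)
  card≤length-allVecs A = length-filter _ (allVecs n)

  ⊆-card-≥⇒⊇ : {A B : Subset n} → A ⊆ B → card B ≤ card A → B ⊆ A
  ⊆-card-≥⇒⊇ {A} A⊆B card-B≤card-A x Bx with A x in Ax
  ... | true  = refl
  ... | false = contradiction card-B≤card-A (ℕ.<⇒≱ (card-mono-< A⊆B x Ax Bx))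

shadow : ∀ {n} → Subset (suc n) → Subset n
shadow A v = A (false ∷ v) ∨ A (true ∷ v)

doubled : ∀ {n} → Subset (suc n) → Subset n
doubled A v = A (false ∷ v) ∧ A (true ∷ v)

shadow-intro : ∀ {n} (A : Subset (suc n)) {b v} → A (b ∷ v) ≡ true → shadow A v ≡ true
shadow-intro A {false}     e rewrite e = refl
shadow-intro A {true}  {v} e rewrite e = 𝔹.∨-zeroʳ (A (false ∷ v))

shadow-elim : ∀ {n} (A : Subset (suc n)) {v} → shadow A v ≡ true → ∃ λ b → A (b ∷ v) ≡ true
shadow-elim A {v} e with A (false ∷ v) in e₀
... | true  = false , e₀
... | false = true , e

card-shadow : ∀ {n} (A : Subset (suc n)) → card A ≡ card (shadow A) + card (doubled A)
card-shadow {n} A = begin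
  length (filterᵇ A (map (false ∷_) vs ++ map (true ∷_) vs))
    ≡⟨ cong length (filter-++ _ (map (false ∷_) vs) _) ⟩
  length (filterᵇ A (map (false ∷_) vs) ++ filterᵇ A (map (true ∷_) vs))
    ≡⟨ length-++ (filterᵇ A (map (false ∷_) vs)) ⟩
  length (filterᵇ A (map (false ∷_) vs)) + length (filterᵇ A (map (true ∷_) vs))
    ≡⟨ cong₂ _+_ (length-filterᵇ-map A (false ∷_) vs) (length-filterᵇ-map A (true ∷_) vs) ⟩
  card (λ v → A (false ∷ v)) + card (λ v → A (true ∷ v))
    ≡⟨ length-filterᵇ-∨-∧ vs ⟩
  card (shadow A) + card (doubled A)
    ∎
  where
  open ≡-Reasoning
  vs : List (Vec Bool n)
  vs = allVecs n

card-∅ : ∀ n → card {n} (λ _ → false) ≡ 0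
card-∅ zero    = refl
card-∅ (suc n) = trans (card-shadow {n} (λ _ → false)) (cong₂ _+_ (card-∅ n) (card-∅ n))

card-pos : ∀ {n} (A : Subset n) x → A x ≡ true → 0 < card A
card-pos {n} A x Ax = subst (_< card A) (card-∅ n) (card-mono-< (λ _ ()) x refl Ax)

shadow-linear : ∀ {n} {A : Subset (suc n)} → Linear A → Linear (shadow A)
shadow-linear {A = A} linear v w Av Aw with shadow-elim A Av | shadow-elim A Aw
... | _ , Abv | _ , Ab′w = Sum.map Pointwise.tail Pointwise.tail (linear _ _ Abv Ab′w)

doubled-unique : ∀ {n} {A : Subset (suc n)} → Linear A →
                 ∀ v w → doubled A v ≡ true → doubled A w ≡ true → v ≡ w
doubled-unique {A = A} linear v w Dv Dw =
  ≼-antisym (below Dv Dw) (below Dw Dv)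
  where
  below : ∀ {x y} → doubled A x ≡ true → doubled A y ≡ true → x ≼ y
  below Dx Dy with linear _ _ (𝔹.∧-conicalˡ _ _ Dx) (𝔹.∧-conicalʳ _ _ Dy)
  ... | inj₁ 0x≼1y = Pointwise.tail 0x≼1y
  ... | inj₂ 1y≼0x = contradiction 1y≼0x true⋠false

card-subsingleton : ∀ {n} (A : Subset n) → (∀ v w → A v ≡ true → A w ≡ true → v ≡ w) → card A ≤ 1
card-subsingleton {zero}  A _      = card≤length-allVecs A
card-subsingleton {suc n} A unique = begin
  card A                              ≡⟨ card-shadow A ⟩
  card (shadow A) + card (doubled A)  ≤⟨ ℕ.+-mono-≤ (card-subsingleton (shadow A) shadow-unique)
                                                   (card-mono no-doubles) ⟩
  1 + card {n} (λ _ → false)          ≡⟨ cong (1 +_) (card-∅ n) ⟩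
  1                                   ∎
  where
  open ℕ.≤-Reasoning
  shadow-unique : ∀ v w → shadow A v ≡ true → shadow A w ≡ true → v ≡ w
  shadow-unique v w Av Aw with shadow-elim A Av | shadow-elim A Aw
  ... | _ , Abv | _ , Ab′w = Vec.∷-injectiveʳ (unique _ _ Abv Ab′w)
  no-doubles : doubled A ⊆ (λ _ → false)
  no-doubles v Dv with () ← unique _ _ (𝔹.∧-conicalˡ _ _ Dv) (𝔹.∧-conicalʳ _ _ Dv)

linear-card : ∀ {n} (A : Subset n) → Linear A → card A ≤ suc n
linear-card {zero}  A _      = card≤length-allVecs A
linear-card {suc n} A linear = begin
  card A                              ≡⟨ card-shadow A ⟩
  card (shadow A) + card (doubled A)  ≤⟨ ℕ.+-mono-≤ (linear-card (shadow A) (shadow-linear linear))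
                                                   (card-subsingleton (doubled A) (doubled-unique linear)) ⟩
  suc n + 1                           ≡⟨ ℕ.+-comm (suc n) 1 ⟩
  suc (suc n)                         ∎
  where open ℕ.≤-Reasoning

-- Extending chains

_≟ᵥ_ : ∀ {n} (x y : Vec Bool n) → Dec (x ≡ y)
_≟ᵥ_ = Vec.≡-dec 𝔹._≟_

insert : ∀ {n} → Vec Bool n → Subset n → Subset n
insert x A y = A y ∨ does (y ≟ᵥ x)

module _ {n} {x : Vec Bool n} {A : Subset n} where

  insert-∋ : insert x A x ≡ true
  insert-∋ rewrite dec-true (x ≟ᵥ x) refl = 𝔹.∨-zeroʳ (A x)

  insert-⊇ : A ⊆ insert x A
  insert-⊇ y Ay rewrite Ay = refl

  insert-elim : ∀ y → insert x A y ≡ true → A y ≡ true ⊎ y ≡ x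
  insert-elim y e with A y | y ≟ᵥ x
  ... | true  | _        = inj₁ refl
  ... | false | yes y≡x = inj₂ y≡x

  insert-chain : ∀ {cs} → Chain cs A → InE cs x → ComparableWith A x → Chain cs (insert x A)
  insert-chain {cs} (inA , cmpA) x∈E cmpx = in′ , cmp′
    where
    in′ : ∀ y → insert x A y ≡ true → InE cs y
    in′ y e with insert-elim y e
    ... | inj₁ Ay   = inA y Ay
    ... | inj₂ refl = x∈E
    cmp′ : Linear (insert x A)
    cmp′ y z ey ez with insert-elim y ey | insert-elim z ez
    ... | inj₁ Ay   | inj₁ Az   = cmpA y z Ay Az
    ... | inj₁ Ay   | inj₂ refl = cmpx y Ay
    ... | inj₂ refl | inj₁ Az   = Sum.swap (cmpx z Az)
    ... | inj₂ refl | inj₂ refl = inj₁ ≼-refl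

  maximal-∋ : ∀ {cs} → MaximalChain cs A → InE cs x → ComparableWith A x → A x ≡ true
  maximal-∋ (chain , maximal) x∈E cmpx =
    maximal (insert x A) (insert-chain chain x∈E cmpx) insert-⊇ x insert-∋

∅-chain : ∀ {n} {cs : Seq n} → Chain cs (λ _ → false)
∅-chain = (λ _ ()) , (λ _ _ ())

extend : ∀ {n} (cs : Seq n) {A} → Chain cs A → ∃ λ M → MaximalChain cs M × A ⊆ M
extend {n} cs chain = go (<-wellFounded _) chain
  where
  go : ∀ {A} → Acc _<_ (length (allVecs n) ∸ card A) → Chain cs A → ∃ λ M → MaximalChain cs M × A ⊆ M
  go {A} (acc smaller) chain
    with any? (λ z → InE? cs z ×-dec (A z 𝔹.≟ false) ×-dec ComparableWith? A z)
  ... | yes (z , z∈E , Az , cmpz) =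
    let grows = card-mono-< (insert-⊇ {x = z}) z Az (insert-∋ {A = A})
        M , M-maximal , ⊆M = go (smaller (ℕ.∸-monoʳ-< grows (card≤length-allVecs (insert z A))))
                                (insert-chain chain z∈E cmpz)
    in M , M-maximal , λ y Ay → ⊆M y (insert-⊇ {x = z} {A} y Ay)
  ... | no nothing-to-add = A , (chain , maximal) , λ _ Ay → Ay
    where
    maximal : ∀ B → Chain cs B → A ⊆ B → B ⊆ A
    maximal B (inB , cmpB) A⊆B z Bz with A z in Az
    ... | true  = refl
    ... | false = contradiction (z , inB z Bz , Az , λ y Ay → cmpB y z (A⊆B y Ay) Bz) nothing-to-add

-- Chains crossing every doubling

DoubledEdge : ∀ {n} → Subset (suc n) → Set
DoubledEdge A = ∃ λ d → A (false ∷ d) ≡ true × A (true ∷ d) ≡ true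

CrossesEveryDoubling : ∀ n → Subset n → Set
CrossesEveryDoubling zero    A = ⊤
CrossesEveryDoubling (suc n) A = DoubledEdge A × CrossesEveryDoubling n (shadow A)

crossing-card : ∀ {n} {A : Subset n} → CrossesEveryDoubling n A → ∀ x → A x ≡ true → suc n ≤ card A
crossing-card {zero}  {A} _                          x Ax = card-pos A x Ax
crossing-card {suc n} {A} ((d , A0d , A1d) , crosses) _ _ = begin
  suc (suc n)                         ≡⟨ ℕ.+-comm 1 (suc n) ⟩
  suc n + 1                           ≤⟨ ℕ.+-mono-≤ (crossing-card crosses d (shadow-intro A A0d))
                                                   (card-pos (doubled A) d (cong₂ _∧_ A0d A1d)) ⟩
  card (shadow A) + card (doubled A)  ≡⟨ card-shadow A ⟨
  card A                              ∎
  where open ℕ.≤-Reasoning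

crossing-chain-maximum : ∀ {n} {cs : Seq n} {A} → Chain cs A → CrossesEveryDoubling n A →
                         ∀ x → A x ≡ true → MaximumChain cs A
crossing-chain-maximum chain crosses x Ax =
  chain , λ B (_ , B-linear) → ℕ.≤-trans (linear-card B B-linear) (crossing-card crosses x Ax)

-- Projection to earlier stages

restrict : ∀ {m n} {ds : Seq m} {cs : Seq n} → ds ⊑ cs → Vec Bool n → Vec Bool m
restrict here      x       = x
restrict (there p) (_ ∷ x) = restrict p x

image : ∀ {m n} {ds : Seq m} {cs : Seq n} → ds ⊑ cs → Subset n → Subset m
image here      A = A
image (there p) A = image p (shadow A)

image-intro : ∀ {m n} {ds : Seq m} {cs : Seq n} (p : ds ⊑ cs) A {x} →
              A x ≡ true → image p A (restrict p x) ≡ true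
image-intro here      A         Ax = Ax
image-intro (there p) A {_ ∷ x} Ax = image-intro p (shadow A) (shadow-intro A Ax)

image-elim : ∀ {m n} {ds : Seq m} {cs : Seq n} (p : ds ⊑ cs) A {w} →
             image p A w ≡ true → ∃ λ x → A x ≡ true × restrict p x ≡ w
image-elim here      A e = _ , e , refl
image-elim (there p) A e with image-elim p (shadow A) e
... | x , Sx , refl with shadow-elim A Sx
...   | b , Abx = b ∷ x , Abx , refl

restrict-onto : ∀ {m n} {ds : Seq m} {cs : Seq n} (p : ds ⊑ cs) {w} →
                InE ds w → ∃ λ x → InE cs x × restrict p x ≡ w
restrict-onto here w∈E = _ , w∈E , refl
restrict-onto (there {ds = cs′} {C = C} p) w∈E with restrict-onto p w∈E
... | x , x∈E , refl with DownSet? cs′ C x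
...   | yes x∈I = false ∷ x , (x∈E , x∈I) , refl
...   | no  x∉I = true ∷ x , (x∈E , inj₁ x∉I) , refl

⊑-valid : ∀ {m n} {ds : Seq m} {cs : Seq n} → ds ⊑ cs → Valid cs → Valid ds
⊑-valid here      valid       = valid
⊑-valid (there p) (valid , _) = ⊑-valid p valid

crosses-image : ∀ {m n} {ds : Seq m} {cs : Seq n} (p : ds ⊑ cs) {A} →
                CrossesEveryDoubling n A → CrossesEveryDoubling m (image p A)
crosses-image here      crosses       = crosses
crosses-image (there p) (_ , crosses) = crosses-image p crosses

crosses-every-stage : ∀ {n} (cs : Seq n) A →
                      (∀ {m} {ds : Seq m} {C} (r : (ds ▷ C) ⊑ cs) → DoubledEdge (image r A)) →
                      CrossesEveryDoubling n A
crosses-every-stage []       A _    = tt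
crosses-every-stage (cs ▷ C) A edge = edge here , crosses-every-stage cs (shadow A) (λ r → edge (there r))

DownSet-lower : ∀ {n} {cs : Seq n} {C} {x y} → DownSet cs C y → x ≼ y → DownSet cs C x
DownSet-lower (z , Cz , y≼z) x≼y = z , Cz , ≼-trans x≼y y≼z

∷-comparable : ∀ {n} b {x y : Vec Bool n} → Comparable x y → Comparable (b ∷ x) (b ∷ y)
∷-comparable b = Sum.map (𝔹.≤-refl ∷_) (𝔹.≤-refl ∷_)

module _ {n} {cs : Seq n} {C : Subset n} where

  InE-tail : ∀ b {x} → InE (cs ▷ C) (b ∷ x) → InE cs x
  InE-tail false = proj₁
  InE-tail true  = proj₁

  InE-doubled : ∀ {x} → C x ≡ true → InE cs x → ∀ b → InE (cs ▷ C) (b ∷ x)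
  InE-doubled Cx x∈E false = x∈E , (_ , Cx , ≼-refl)
  InE-doubled Cx x∈E true  = x∈E , inj₂ Cx

  doubledEdge-over-C : ∀ {d} → InE (cs ▷ C) (false ∷ d) → InE (cs ▷ C) (true ∷ d) → C d ≡ true
  doubledEdge-over-C (_ , d∈I) (_ , inj₁ d∉I) = contradiction d∈I d∉I
  doubledEdge-over-C _         (_ , inj₂ Cd)  = Cd

  shadow-chain : ∀ {M} → Chain (cs ▷ C) M → Chain cs (shadow M)
  shadow-chain {M} (inM , linear) =
    (λ v Sv → let b , Mbv = shadow-elim M Sv in InE-tail b (inM _ Mbv)) , shadow-linear linear

  module _ {M : Subset (suc n)} (chain : Chain (cs ▷ C) M) {z : Vec Bool n}
           (cmp : ComparableWith (shadow M) z) where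

    lift-outside : ¬ DownSet cs C z → ComparableWith M (true ∷ z)
    lift-outside z∉I (b ∷ m) Mbm with cmp m (shadow-intro M Mbm)
    ... | inj₁ m≼z = inj₁ (𝔹.≤-maximum b ∷ m≼z)
    lift-outside z∉I (true  ∷ m) Mbm | inj₂ z≼m = inj₂ (b≤b ∷ z≼m)
    lift-outside z∉I (false ∷ m) Mbm | inj₂ z≼m =
      contradiction (DownSet-lower {cs = cs} {C} (proj₂ (proj₁ chain _ Mbm)) z≼m) z∉I

    lift-below : NonemptyConvex cs C → InE cs z → DownSet cs C z → C z ≢ true → ComparableWith M (false ∷ z)
    lift-below (_ , _ , convex) z∈E z∈I z∉C (b ∷ m) Mbm with cmp m (shadow-intro M Mbm)
    ... | inj₂ z≼m = inj₂ (𝔹.≤-minimum b ∷ z≼m)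
    lift-below _ _ _ _ (false ∷ m) Mbm | inj₁ m≼z = inj₁ (b≤b ∷ m≼z)
    lift-below (_ , _ , convex) z∈E z∈I@(x , Cx , z≼x) z∉C (true ∷ m) Mbm | inj₁ m≼z
      with proj₂ (proj₁ chain _ Mbm)
    ... | inj₁ m∉I = contradiction (DownSet-lower {cs = cs} {C} z∈I m≼z) m∉I
    ... | inj₂ Cm  = contradiction (convex m z x z∈E Cm Cx m≼z z≼x) z∉C

    lift-inside-low : ∀ {m₀} → M (false ∷ m₀) ≡ true → ¬ m₀ ≼ z → ComparableWith M (false ∷ z)
    lift-inside-low M0m₀ m₀⋠z (false ∷ m) Mm = ∷-comparable false (cmp m (shadow-intro M Mm))
    lift-inside-low M0m₀ m₀⋠z (true  ∷ m) Mm with cmp m (shadow-intro M Mm)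
    ... | inj₂ z≼m = inj₂ (f≤t ∷ z≼m)
    ... | inj₁ m≼z with proj₂ chain _ _ Mm M0m₀
    ...   | inj₁ 1m≼0m₀ = contradiction 1m≼0m₀ true⋠false
    ...   | inj₂ 0m₀≼1m = contradiction (≼-trans (Pointwise.tail 0m₀≼1m) m≼z) m₀⋠z

    lift-inside-high : (∀ {m} → M (false ∷ m) ≡ true → m ≼ z) → ComparableWith M (true ∷ z)
    lift-inside-high below (false ∷ m) Mm = inj₁ (f≤t ∷ below Mm)
    lift-inside-high below (true  ∷ m) Mm = ∷-comparable true (cmp m (shadow-intro M Mm))

    lift-inside : ∃ λ b → ComparableWith M (b ∷ z)
    lift-inside with any? (λ m → (M (false ∷ m) 𝔹.≟ true) ×-dec ¬? (m ≼? z))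
    ... | yes (_ , M0m₀ , m₀⋠z) = false , lift-inside-low M0m₀ m₀⋠z
    ... | no  none-above        =
      true , lift-inside-high λ {m} M0m → decidable-stable (m ≼? z) λ m⋠z → none-above (m , M0m , m⋠z)

  lift-comparable : ∀ {M z} → NonemptyConvex cs C → Chain (cs ▷ C) M → InE cs z →
                    ComparableWith (shadow M) z → ∃ λ b → InE (cs ▷ C) (b ∷ z) × ComparableWith M (b ∷ z)
  lift-comparable {z = z} convex chain z∈E cmp with DownSet? cs C z | C z 𝔹.≟ true
  ... | no  z∉I | _       = true , (z∈E , inj₁ z∉I) , lift-outside chain cmp z∉I
  ... | yes z∈I | no  z∉C = false , (z∈E , z∈I) , lift-below chain cmp convex z∈E z∈I z∉C
  ... | yes _   | yes z∈C = let b , cmp′ = lift-inside chain cmp in b , InE-doubled z∈C z∈E b , cmp′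

  shadow-maximal : ∀ {M} → NonemptyConvex cs C → MaximalChain (cs ▷ C) M → MaximalChain cs (shadow M)
  shadow-maximal {M} convex M-maximal@(chain , _) = shadow-chain chain , maximal
    where
    maximal : ∀ B → Chain cs B → shadow M ⊆ B → B ⊆ shadow M
    maximal B (inB , B-linear) ⊆B z Bz =
      let b , bz∈E , cmp = lift-comparable convex chain (inB z Bz) (λ y Sy → B-linear y z (⊆B y Sy) Bz)
      in shadow-intro M (maximal-∋ M-maximal bz∈E cmp)

image-maximal : ∀ {m n} {ds : Seq m} {cs : Seq n} (p : ds ⊑ cs) {M} →
                Valid cs → MaximalChain cs M → MaximalChain ds (image p M)
image-maximal here      _                M-maximal = M-maximal
image-maximal (there p) (valid , convex) M-maximal = image-maximal p valid (shadow-maximal convex M-maximal)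

-- Doubled edges in maximal chains

module _ {a ℓ} {A : Set a} {_≤_ : Rel A ℓ} (≤-refl : Reflexive _≤_) (≤-trans : Transitive _≤_)
         {P : A → Bool} (total : ∀ x y → P x ≡ true → P y ≡ true → x ≤ y ⊎ y ≤ x) where

  greatest-in : ∀ xs {x₀} → P x₀ ≡ true →
                ∃ λ m → P m ≡ true × x₀ ≤ m × (∀ {x} → x ∈ xs → P x ≡ true → x ≤ m)
  greatest-in [] {x₀} Px₀ = x₀ , Px₀ , ≤-refl , λ ()
  greatest-in (y ∷ xs) {x₀} Px₀ with P y in Py
  ... | false = let m , Pm , x₀≤m , ub = greatest-in xs Px₀ in
    m , Pm , x₀≤m , λ { (here refl) Py′ → contradiction (trans (sym Py′) Py) λ () ; (there x∈xs) → ub x∈xs }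
  ... | true with total x₀ y Px₀ Py
  ...   | inj₁ x₀≤y = let m , Pm , y≤m , ub = greatest-in xs Py in
    m , Pm , ≤-trans x₀≤y y≤m , λ { (here refl) _ → y≤m ; (there x∈xs) → ub x∈xs }
  ...   | inj₂ y≤x₀ = let m , Pm , x₀≤m , ub = greatest-in xs Px₀ in
    m , Pm , x₀≤m , λ { (here refl) _ → ≤-trans y≤x₀ x₀≤m ; (there x∈xs) → ub x∈xs }

MeetsDoubling : ∀ {n} → Subset n → Subset (suc n) → Set
MeetsDoubling C A = ∃₂ λ b c → C c ≡ true × A (b ∷ c) ≡ true

module _ {n} {cs : Seq n} {C : Subset n} {A : Subset (suc n)} (A-maximal : MaximalChain (cs ▷ C) A) where

  private
    inA : ∀ x → A x ≡ true → InE (cs ▷ C) x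
    inA = proj₁ (proj₁ A-maximal)
    linear : Linear A
    linear = proj₂ (proj₁ A-maximal)

  doubledEdge-above : NonemptyConvex cs C → ∀ {c} → C c ≡ true → A (false ∷ c) ≡ true → DoubledEdge A
  doubledEdge-above (_ , _ , convex) {c} Cc A0c
    with greatest-in ≼-refl ≼-trans {P = λ v → A (false ∷ v)}
                     (λ x y A0x A0y → Sum.map Pointwise.tail Pointwise.tail (linear _ _ A0x A0y))
                     (allVecs n) A0c
  ... | a , A0a , c≼a , ub = a , A0a , maximal-∋ A-maximal (a∈E , inj₂ Ca) above-all
    where
    a∈E : InE cs a
    a∈E = proj₁ (inA _ A0a)
    Ca : C a ≡ true
    Ca = let x , Cx , a≼x = proj₂ (inA _ A0a) in convex c a x a∈E Cc Cx c≼a a≼x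
    above-all : ComparableWith A (true ∷ a)
    above-all (false ∷ w) A0w = inj₁ (f≤t ∷ ub (allVecs-complete w) A0w)
    above-all (true  ∷ w) A1w with linear _ _ A0a A1w
    ... | inj₁ 0a≼1w = inj₂ (b≤b ∷ Pointwise.tail 0a≼1w)
    ... | inj₂ 1w≼0a = contradiction 1w≼0a true⋠false

  doubledEdge-below : ∀ {c} → C c ≡ true → A (true ∷ c) ≡ true → DoubledEdge A
  doubledEdge-below {c} Cc A1c
    with greatest-in ≼-refl (λ y≼x z≼y → ≼-trans z≼y y≼x) {P = λ v → A (true ∷ v)}
                     (λ x y A1x A1y → Sum.swap (Sum.map Pointwise.tail Pointwise.tail (linear _ _ A1x A1y)))
                     (allVecs n) A1c
  ... | a , A1a , a≼c , lb = a , maximal-∋ A-maximal (a∈E , (c , Cc , a≼c)) below-all , A1a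
    where
    a∈E : InE cs a
    a∈E = proj₁ (inA _ A1a)
    below-all : ComparableWith A (false ∷ a)
    below-all (true  ∷ w) A1w = inj₂ (f≤t ∷ lb (allVecs-complete w) A1w)
    below-all (false ∷ w) A0w with linear _ _ A0w A1a
    ... | inj₁ 0w≼1a = inj₁ (b≤b ∷ Pointwise.tail 0w≼1a)
    ... | inj₂ 1a≼0w = contradiction 1a≼0w true⋠false

  meets⇒doubledEdge : NonemptyConvex cs C → MeetsDoubling C A → DoubledEdge A
  meets⇒doubledEdge convex (false , _ , Cc , A0c) = doubledEdge-above convex Cc A0c
  meets⇒doubledEdge _      (true  , _ , Cc , A1c) = doubledEdge-below Cc A1c

-- Shellings

argmax-upTo : ∀ {k} (f : Fin (suc k) → ℕ) (m : Fin k) →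
             ∃ λ i → toℕ i ≤ toℕ m × (∀ j → toℕ j ≤ toℕ m → f j ≤ f i)
argmax-upTo f fzero = fzero , z≤n , λ { fzero _ → ℕ.≤-refl }
argmax-upTo f (fsuc m) with argmax-upTo (f ∘ fsuc) m
... | i , i≤m , best with f fzero ≤? f (fsuc i)
...   | yes f₀≤ = fsuc i , s≤s i≤m , λ { fzero _ → f₀≤ ; (fsuc j) (s≤s j≤m) → best j j≤m }
...   | no  f₀≰ = fzero , z≤n ,
                  λ { fzero _ → ℕ.≤-refl ; (fsuc j) (s≤s j≤m) → ℕ.≤-trans (best j j≤m) (ℕ.<⇒≤ (ℕ.≰⇒> f₀≰)) }

2+m≤n⇒m≢n∸1 : ∀ {a b} → 2 + a ≤ b → a ≢ b ∸ 1
2+m≤n⇒m≢n∸1 {a} {suc b} (s≤s a<b) refl = ℕ.n≮n a a<b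

shelling-step : ∀ {n k} (F : Fin (suc k) → Subset n) (m : Fin k) →
                PureOfSize (PrefixIntersection F (fsuc m)) (card (F (fsuc m)) ∸ 1) →
                ∀ {x y} → F (fsuc m) x ≡ true → F (fsuc m) y ≡ true → x ≢ y →
                ∃ λ i → toℕ i ≤ toℕ m × (F i x ≡ true ⊎ F i y ≡ true)
shelling-step {n} F m pure {x} {y} Fx Fy x≢y with argmax-upTo (λ i → card (F (fsuc m) ∩ F i)) m
... | i , i≤m , best with (F (fsuc m) ∩ F i) x in Gx | (F (fsuc m) ∩ F i) y in Gy
...   | true  | _     = i , i≤m , inj₁ (𝔹.∧-conicalʳ _ _ Gx)
...   | false | true  = i , i≤m , inj₂ (𝔹.∧-conicalʳ _ _ Gy)
...   | false | false = contradiction (pure G G-facet) (2+m≤n⇒m≢n∸1 (ℕ.≤-trans (s≤s G<G+x) G+x<F))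
  where
  G : Subset n
  G = F (fsuc m) ∩ F i
  G-facet : IsFacetOf (PrefixIntersection F (fsuc m)) G
  G-facet = ((λ _ → 𝔹.∧-conicalˡ _ _) , i , s≤s i≤m , (λ _ → 𝔹.∧-conicalʳ _ _)) ,
            λ { G′ (G′⊆F , j , s≤s j≤m , G′⊆Fj) G⊆G′ →
                  ⊆-card-≥⇒⊇ G⊆G′ (ℕ.≤-trans (card-mono (λ z G′z → cong₂ _∧_ (G′⊆F z G′z) (G′⊆Fj z G′z)))
                                              (best j j≤m)) }
  G<G+x : card G < card (insert x G)
  G<G+x = card-mono-< (insert-⊇ {x = x}) x Gx (insert-∋ {A = G})
  G+x⊆F : insert x G ⊆ F (fsuc m)
  G+x⊆F z e with insert-elim {x = x} {G} z e
  ... | inj₁ Gz   = 𝔹.∧-conicalˡ (F (fsuc m) z) _ Gz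
  ... | inj₂ refl = Fx
  y∉G+x : insert x G y ≡ false
  y∉G+x rewrite Gy | dec-false (y ≟ᵥ x) (x≢y ∘ sym) = refl
  G+x<F : card (insert x G) < card (F (fsuc m))
  G+x<F = card-mono-< G+x⊆F y y∉G+x Fy

module FirstFacet {n k} {cs : Seq n} (valid : Valid cs) (F : Fin (suc k) → Subset n)
                  (maximal : ∀ i → MaximalChain cs (F i))
                  (complete : ∀ A → MaximalChain cs A → ∃ λ i → (A ⊆ F i) × (F i ⊆ A))
                  (pure : ∀ m → 1 ≤ toℕ m → PureOfSize (PrefixIntersection F m) (card (F m) ∸ 1)) where

  facet-through : ∀ {x} → InE cs x → ∃ λ i → F i x ≡ true
  facet-through {x} x∈E =
    let M , M-maximal , x∈M = extend cs (insert-chain ∅-chain x∈E (λ _ ()))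
        i , M⊆Fi , _ = complete M M-maximal
    in i , M⊆Fi x (x∈M x (insert-∋ {x = x} {A = λ _ → false}))

  module Stage {m} {ds : Seq m} {C : Subset m} (r : (ds ▷ C) ⊑ cs) where

    convex : NonemptyConvex ds C
    convex = proj₂ (⊑-valid r valid)

    maximal-image : ∀ i → MaximalChain (ds ▷ C) (image r (F i))
    maximal-image i = image-maximal r valid (maximal i)

    image-edge-over-C : ∀ i {d} → image r (F i) (false ∷ d) ≡ true → image r (F i) (true ∷ d) ≡ true →
                        C d ≡ true
    image-edge-over-C i e₀ e₁ =
      let inE = proj₁ (proj₁ (maximal-image i)) in doubledEdge-over-C (inE _ e₀) (inE _ e₁)

    meets-via : ∀ i {x b c} → F i x ≡ true → restrict r x ≡ b ∷ c → C c ≡ true →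
                MeetsDoubling C (image r (F i))
    meets-via i {b = b} {c} Fix x↦bc Cc =
      b , c , Cc , subst (λ w → image r (F i) w ≡ true) x↦bc (image-intro r (F i) Fix)

    some-facet-meets : ∃ λ i → MeetsDoubling C (image r (F i))
    some-facet-meets =
      let c , Cc = proj₁ (proj₂ convex)
          x , x∈E , x↦0c = restrict-onto r {false ∷ c} (InE-doubled Cc (proj₁ convex c Cc) false)
          i , Fix = facet-through x∈E
      in i , meets-via i Fix x↦0c Cc

    earlier-facet-meets : ∀ j → DoubledEdge (image r (F (fsuc j))) →
                          ∃ λ i → toℕ i ≤ toℕ j × MeetsDoubling C (image r (F i))
    earlier-facet-meets j (d , e₀ , e₁) with image-elim r _ e₀ | image-elim r _ e₁
    ... | x , Fx , x↦0d | y , Fy , y↦1d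
      with shelling-step F j (pure (fsuc j) (s≤s z≤n)) Fx Fy
                         (λ { refl → contradiction (trans (sym x↦0d) y↦1d) λ () })
    ...   | i , i≤j , inj₁ Fix = i , i≤j , meets-via i Fix x↦0d (image-edge-over-C (fsuc j) e₀ e₁)
    ...   | i , i≤j , inj₂ Fiy = i , i≤j , meets-via i Fiy y↦1d (image-edge-over-C (fsuc j) e₀ e₁)

    first-facet-meets : MeetsDoubling C (image r (F fzero))
    first-facet-meets = descend _ (Fin.<-wellFounded _) (proj₂ some-facet-meets)
      where
      descend : ∀ j → Acc Fin._<_ j → MeetsDoubling C (image r (F j)) → MeetsDoubling C (image r (F fzero))
      descend fzero    _              meets = meets
      descend (fsuc j) (acc earlier) meets =
        let i , i≤j , meets′ =
              earlier-facet-meets j (meets⇒doubledEdge (maximal-image (fsuc j)) convex meets)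
        in descend i (earlier (s≤s i≤j)) meets′

  crosses : CrossesEveryDoubling n (F fzero)
  crosses = crosses-every-stage cs (F fzero) λ r →
    let open Stage r in meets⇒doubledEdge (maximal-image fzero) convex first-facet-meets

theorem3p24 : ∀ {n} (cs : Seq n) → Valid cs → Shellable cs →
                ∀ {i} (ds : Seq i) (C : Subset i) → (ds ▷ C) ⊑ cs →
                ∃ λ x → C x ≡ true × Spine ds x
theorem3p24 cs valid (zero , _ , _ , complete , _) ds C p
  with () ← proj₁ (complete _ (proj₁ (proj₂ (extend cs ∅-chain))))
theorem3p24 cs valid (suc k , F , maximal , complete , _ , pure) {i} ds C p
  with crosses-image p (FirstFacet.crosses valid F maximal complete pure)
... | (d , e₀ , e₁) , crosses-below =
  d , doubledEdge-over-C (inE _ e₀) (inE _ e₁) ,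
  shadow F₀ , crossing-chain-maximum (shadow-chain F₀-chain) crosses-below d (shadow-intro F₀ e₀) ,
  shadow-intro F₀ e₀
  where
  F₀ : Subset (suc i)
  F₀ = image p (F fzero)
  F₀-chain : Chain (ds ▷ C) F₀
  F₀-chain = proj₁ (image-maximal p valid (maximal fzero))
  inE : ∀ x → F₀ x ≡ true → InE (ds ▷ C) x
  inE = proj₁ F₀-chain
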